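{- Let $\mathbb{K}$ be a field of characteristic zero and let $D=(d_{n,j})_{n,j\in\mathbb{N}}$ be an infinite lower triangular matrix with entries in $\mathbb{K}$, with associated family of polynomials $p_n(x)=\sum_{j=0}^n d_{n,j}x^j$, $n\in\mathbb{N}$. Then $D=T(f\mid g)$ for some power series $f,g\in\mathbb{K}[[x]]$ with $g(0)\neq 0$ if and only if there exist two sequences $(f_n)_{n\in\mathbb{N}}$ and $(g_n)_{n\in\mathbb{N}}$ in $\mathbb{K}$ with $g_0\neq 0$ such that for all $n\geq 0$ \[ p_n(x)=\left(\frac{x-g_1}{g_0}\right)p_{n-1}(x)-\frac{g_2}{g_0}p_{n-2}(x)-\cdots-\frac{g_{n}}{g_0}p_{0}(x)+\frac{f_{n}}{g_0}, \] (with the convention $p_{ -1}=0$ and empty sums equal to zero, so that $p_0=f_0/g_0$). Moreover, in this case $D=T(f\mid g)$ where $f=\sum_{n\geq0}f_nx^n$ and $g=\sum_{n\geq0}g_nx^n$.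
   Context: For $f=\sum_{n\ge0} f_nx^n$, $g=\sum_{n\ge0} g_nx^n\in\mathbb{K}[[x]]$ with $g_0\neq0$, $T(f\mid g)=(d_{n,k})_{n,k\geq0}$ denotes the infinite lower triangular matrix whose $k$-th column ($k\ge0$) has generating function $\frac{f(x)}{g(x)}\left(\frac{x}{g(x)}\right)^k$, i.e. $d_{n,k}$ is the coefficient of $x^n$ in $f(x)x^k/g(x)^{k+1}$. For an infinite lower triangular matrix $A=(a_{n,j})$, its associated family of polynomials is $p_n(x)=\sum_{j=0}^n a_{n,j}x^j$. -}

module Defs where

open import Level using (Level; _⊔_) renaming (suc to lsuc)
open import Data.Nat using (ℕ; zero; suc; _∸_; _<_; _≤?_; _<?_)
open import Data.Product using (∃; proj₁; _×_; Σ)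
open import Data.Bool using (if_then_else_)
open import Relation.Nullary using (¬_; does)
open import Algebra.Bundles using (CommutativeRing)

record Field (c ℓ : Level) : Set (lsuc (c ⊔ ℓ)) where
  field
    commutativeRing : CommutativeRing c ℓ
  open CommutativeRing commutativeRing public
  field
    0≉1     : ¬ (0# ≈ 1#)
    inverse : ∀ x → ¬ (x ≈ 0#) → ∃ λ y → x * y ≈ 1#

module _ {c ℓ : Level} (K : Field c ℓ) where
  open Field K

  natCast : ℕ → Carrier
  natCast zero    = 0#
  natCast (suc n) = 1# + natCast n

  CharZero : Set ℓ
  CharZero = ∀ n → ¬ (natCast (suc n) ≈ 0#)

  inv : (x : Carrier) → ¬ (x ≈ 0#) → Carrier
  inv x x≉0 = proj₁ (inverse x x≉0)

  -- formal power series over K (also used for polynomials), given by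
  -- their coefficient sequences:  a n = coefficient of x^n
  Series : Set c
  Series = ℕ → Carrier

  sumBelow : ℕ → (ℕ → Carrier) → Carrier
  sumBelow zero    h = 0#
  sumBelow (suc n) h = sumBelow n h + h n

  zeroS : Series
  zeroS _ = 0#

  constS : Carrier → Series
  constS a zero    = a
  constS a (suc _) = 0#

  oneS : Series
  oneS = constS 1#

  xS : Series
  xS (suc zero) = 1#
  xS _          = 0#

  _+S_ : Series → Series → Series
  (a +S b) n = a n + b n

  _-S_ : Series → Series → Series
  (a -S b) n = a n - b n

  _·S_ : Carrier → Series → Series
  (r ·S a) n = r * a n

  _*S_ : Series → Series → Series
  (a *S b) n = sumBelow (suc n) (λ i → a i * b (n ∸ i))

  powS : Series → ℕ → Series
  powS a zero    = oneS
  powS a (suc k) = a *S powS a k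

  -- x^k · a
  shiftS : ℕ → Series → Series
  shiftS k a n = if does (n <? k) then 0# else a (n ∸ k)

  -- Multiplicative inverse 1/g of a series with g 0 ≠ 0, by the usual
  -- recursion  h 0 = g0⁻¹,  h (n+1) = - g0⁻¹ Σ_{i=1}^{n+1} g i · h (n+1-i).
  -- invTab g g0⁻¹ n m is correct for all m ≤ n.
  invTab : Series → Carrier → ℕ → ℕ → Carrier
  invTab g g0i zero    m = g0i
  invTab g g0i (suc n) m =
    if does (m ≤? n) then invTab g g0i n m
    else - (g0i * sumBelow (suc n) (λ i → g (suc i) * invTab g g0i n (n ∸ i)))

  invS : (g : Series) → ¬ (g 0 ≈ 0#) → Series
  invS g g0≉0 n = invTab g (inv (g 0) g0≉0) n n

  T : (f g : Series) → ¬ (g 0 ≈ 0#) → ℕ → ℕ → Carrier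
  T f g g0≉0 n k = (shiftS k f *S powS (invS g g0≉0) (suc k)) n

  Matrix : Set c
  Matrix = ℕ → ℕ → Carrier

  LowerTriangular : Matrix → Set ℓ
  LowerTriangular d = ∀ n j → n < j → d n j ≈ 0#

  _≈M_ : Matrix → Matrix → Set ℓ
  d ≈M e = ∀ n k → d n k ≈ e n k

  _≈S_ : Series → Series → Set ℓ
  a ≈S b = ∀ j → a j ≈ b j

  polys : Matrix → ℕ → Series
  polys d n j = d n j

  -- right-hand side of the recurrence, with g0⁻¹ the inverse of g 0:
  --  n = 0   :  f_0/g_0                      (p_{-1} = 0, empty sum)
  --  n = m+1 :  ((x - g_1)/g_0) p_m - Σ_{i=2}^{m+1} (g_i/g_0) p_{m+1-i}
  --             + f_{m+1}/g_0
  recRHS : Matrix → (f g : Series) → Carrier → ℕ → Series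
  recRHS d f g g0i zero    = constS (f 0 * g0i)
  recRHS d f g g0i (suc m) =
    (((g0i ·S (xS -S constS (g 1))) *S polys d m)
      -S (λ j → sumBelow m (λ t → ((g (suc (suc t)) * g0i) ·S polys d (m ∸ suc t)) j)))
    +S constS (f (suc m) * g0i)
    -- the sum: i = t + 2 with t < m, so p_{m+1-i} = p_{m-1-t} = p_{m ∸ suc t}

  Recurrence : Matrix → (f g : Series) → ¬ (g 0 ≈ 0#) → Set ℓ
  Recurrence d f g g0≉0 = ∀ n → polys d n ≈S recRHS d f g (inv (g 0) g0≉0) n

module Submission where

-- Characterisation of Riordan-type matrices T(f | g) by a recurrence on the
-- rows.  Write h = 1/g and C_k = x^k f h^(k+1) for the k-th column of
-- T(f | g), and v = 1/g₀.
--
--  * Since g h = 1 we get g C_k = x^k f h^k, i.e. g C_0 = f and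
--    g C_(k+1) = x C_k.  Comparing coefficients of x^(m+1) and solving for
--    the leading term g₀ C_k(m+1) expresses row m+1 of T(f | g) through
--    rows 0 … m; this is exactly the recurrence of the theorem, so T(f | g)
--    satisfies it (`T-recurrence`).
--  * The recurrence determines every row from the previous ones, hence any
--    two matrices satisfying it with the same f, g coincide (`recurrence-unique`).
--
-- Both directions of the equivalence and the "moreover" part follow.

open import Defs
open import Level using (Level)
open import Data.Product using (_×_; Σ; _,_; proj₂)
open import Relation.Nullary using (¬_)
open import Function.Bundles using (_⇔_; mk⇔)
open import Data.Maybe using (nothing)
open import Data.Sum using (inj₁; inj₂)
open import Data.Empty using (⊥-elim)
open import Data.Bool using (true; false)
open import Data.Unit using (tt)
open import Data.Nat using (ℕ; zero; suc; _∸_; _<_; _≤_; _≤ᵇ_; z≤n; s≤s)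
import Data.Nat.Properties as ℕ
import Relation.Binary.PropositionalEquality as P
open import Tactic.RingSolver.Core.AlmostCommutativeRing using (fromCommutativeRing)

module Development {c ℓ : Level} (K : Field c ℓ) where
  open Field K hiding (zero)
  open import Relation.Binary.Reasoning.Setoid setoid
  open import Algebra.Properties.Ring ring using (-‿distribˡ-*; -‿distribʳ-*; -0#≈0#)
  open import Tactic.RingSolver.NonReflective
    (fromCommutativeRing commutativeRing (λ _ → nothing))

  ≡⇒≈ : ∀ {x y} → x P.≡ y → x ≈ y
  ≡⇒≈ P.refl = refl

  Σ< : ℕ → (ℕ → Carrier) → Carrier
  Σ< = sumBelow K

  sum-cong< : ∀ n {a b : ℕ → Carrier} → (∀ i → i < n → a i ≈ b i) → Σ< n a ≈ Σ< n b
  sum-cong< zero    eq = refl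
  sum-cong< (suc n) eq = +-cong (sum-cong< n (λ i i<n → eq i (ℕ.m<n⇒m<1+n i<n)))
                                (eq n (ℕ.n<1+n n))

  sum-cong : ∀ n {a b : ℕ → Carrier} → (∀ i → a i ≈ b i) → Σ< n a ≈ Σ< n b
  sum-cong n eq = sum-cong< n (λ i _ → eq i)

  sum-first : ∀ n (a : ℕ → Carrier) → Σ< (suc n) a ≈ a 0 + Σ< n (λ i → a (suc i))
  sum-first zero    a = trans (+-identityˡ (a 0)) (sym (+-identityʳ (a 0)))
  sum-first (suc n) a = trans (+-cong (sum-first n a) refl) (+-assoc _ _ _)

  sum-scale : ∀ n r (a : ℕ → Carrier) → Σ< n (λ i → r * a i) ≈ r * Σ< n a
  sum-scale zero    r a = sym (zeroʳ r)
  sum-scale (suc n) r a = trans (+-cong (sum-scale n r a) refl) (sym (distribˡ r _ _))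

  sum-add : ∀ n (a b : ℕ → Carrier) → Σ< n (λ i → a i + b i) ≈ Σ< n a + Σ< n b
  sum-add zero    a b = sym (+-identityʳ 0#)
  sum-add (suc n) a b = trans (+-cong (sum-add n a b) refl) (interchange _ _ _ _)
    where
    interchange : ∀ w x y z → (w + x) + (y + z) ≈ (w + y) + (x + z)
    interchange = solve 4 (λ w x y z → ((w ⊕ x) ⊕ (y ⊕ z)) ⊜ ((w ⊕ y) ⊕ (x ⊕ z))) refl

  sum-zero : ∀ n → Σ< n (λ _ → 0#) ≈ 0#
  sum-zero zero    = refl
  sum-zero (suc n) = trans (+-identityʳ _) (sum-zero n)

  sum-reverse : ∀ n (a : ℕ → Carrier) → Σ< (suc n) a ≈ Σ< (suc n) (λ i → a (n ∸ i))
  sum-reverse zero    a = refl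
  sum-reverse (suc n) a = begin
      Σ< (suc (suc n)) a
    ≈⟨ sum-first (suc n) a ⟩
      a 0 + Σ< (suc n) (λ i → a (suc i))
    ≈⟨ +-cong refl (sum-reverse n (λ i → a (suc i))) ⟩
      a 0 + Σ< (suc n) (λ i → a (suc (n ∸ i)))
    ≈⟨ +-cong refl (sum-cong< (suc n) λ i i≤n →
         ≡⇒≈ (P.cong a (P.sym (ℕ.+-∸-assoc 1 (ℕ.≤-pred i≤n))))) ⟩
      a 0 + Σ< (suc n) (λ i → a (suc n ∸ i))
    ≈⟨ +-comm _ _ ⟩
      Σ< (suc n) (λ i → a (suc n ∸ i)) + a 0
    ≈⟨ +-cong refl (≡⇒≈ (P.cong a (P.sym (ℕ.n∸n≡0 n)))) ⟩
      Σ< (suc (suc n)) (λ i → a (suc n ∸ i))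
    ∎

  infix 4 _≋_
  _≋_ : Series K → Series K → Set ℓ
  _≋_ = _≈S_ K

  infixl 7 _⊙_
  _⊙_ : Series K → Series K → Series K
  _⊙_ = _*S_ K

  tail : Series K → Series K
  tail a i = a (suc i)

  coeff-zero : ∀ a b → (a ⊙ b) 0 ≈ a 0 * b 0
  coeff-zero a b = +-identityˡ _

  coeff-suc : ∀ a b n → (a ⊙ b) (suc n) ≈ a 0 * b (suc n) + (tail a ⊙ b) n
  coeff-suc a b n = sum-first (suc n) (λ i → a i * b (suc n ∸ i))

  coeff-suc₂ : ∀ a b n → (a ⊙ b) (suc n)
    ≈ a 0 * b (suc n) + (a 1 * b n + Σ< n (λ t → a (suc (suc t)) * b (n ∸ suc t)))
  coeff-suc₂ a b n = trans (coeff-suc a b n)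
                           (+-cong refl (sum-first n (λ i → a (suc i) * b (n ∸ i))))

  ⊙-cong : ∀ {a a′ b b′} → a ≋ a′ → b ≋ b′ → (a ⊙ b) ≋ (a′ ⊙ b′)
  ⊙-cong a≈ b≈ n = sum-cong (suc n) (λ i → *-cong (a≈ i) (b≈ (n ∸ i)))

  ⊙-zeroˡ : ∀ {a} b → a ≋ zeroS K → (a ⊙ b) ≋ zeroS K
  ⊙-zeroˡ b a≈0 n =
    trans (sum-cong (suc n) (λ i → trans (*-cong (a≈0 i) refl) (zeroˡ _))) (sum-zero (suc n))

  ⊙-comm : ∀ a b → (a ⊙ b) ≋ (b ⊙ a)
  ⊙-comm a b n = trans (sum-reverse n _) (sum-cong< (suc n) λ i i≤n →
    trans (*-cong refl (≡⇒≈ (P.cong b (ℕ.m∸[m∸n]≡n (ℕ.≤-pred i≤n))))) (*-comm _ _))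

  ⊙-constant : ∀ a b → tail a ≋ zeroS K → ∀ n → (a ⊙ b) n ≈ a 0 * b n
  ⊙-constant a b tail≈0 zero    = coeff-zero a b
  ⊙-constant a b tail≈0 (suc n) =
    trans (coeff-suc a b n) (trans (+-cong refl (⊙-zeroˡ b tail≈0 n)) (+-identityʳ _))

  ⊙-identityˡ : ∀ a → (oneS K ⊙ a) ≋ a
  ⊙-identityˡ a n = trans (⊙-constant (oneS K) a (λ _ → refl) n) (*-identityˡ _)

  ⊙-identityʳ : ∀ a → (a ⊙ oneS K) ≋ a
  ⊙-identityʳ a n = trans (⊙-comm a (oneS K) n) (⊙-identityˡ a n)

  ⊙-linearˡ : ∀ r a b c → ((λ i → r * a i + b i) ⊙ c) ≋ (λ n → r * (a ⊙ c) n + (b ⊙ c) n)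
  ⊙-linearˡ r a b c n = trans (sum-cong (suc n) (λ i → distributeˡ (a i) (b i) (c (n ∸ i))))
    (trans (sum-add (suc n) _ _) (+-cong (sum-scale (suc n) r _) refl))
    where
    distributeˡ : ∀ x y z → (r * x + y) * z ≈ r * (x * z) + y * z
    distributeˡ x y z = trans (distribʳ z (r * x) y) (+-cong (*-assoc r x z) refl)

  -- Associativity, by induction on the coefficient index using
  -- (a b) c = a₀ (b c) + x ((tail a) b) c.
  ⊙-assoc : ∀ a b c → ((a ⊙ b) ⊙ c) ≋ (a ⊙ (b ⊙ c))
  ⊙-assoc a b c zero = begin
      ((a ⊙ b) ⊙ c) 0        ≈⟨ coeff-zero (a ⊙ b) c ⟩
      (a ⊙ b) 0 * c 0        ≈⟨ *-cong (coeff-zero a b) refl ⟩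
      (a 0 * b 0) * c 0      ≈⟨ *-assoc (a 0) (b 0) (c 0) ⟩
      a 0 * (b 0 * c 0)      ≈⟨ *-cong refl (coeff-zero b c) ⟨
      a 0 * (b ⊙ c) 0        ≈⟨ coeff-zero a (b ⊙ c) ⟨
      (a ⊙ (b ⊙ c)) 0        ∎
  ⊙-assoc a b c (suc n) = begin
      ((a ⊙ b) ⊙ c) (suc n)
    ≈⟨ coeff-suc (a ⊙ b) c n ⟩
      (a ⊙ b) 0 * c (suc n) + (tail (a ⊙ b) ⊙ c) n
    ≈⟨ +-cong (*-cong (coeff-zero a b) refl) (⊙-cong {b = c} (coeff-suc a b) (λ _ → refl) n) ⟩
      (a 0 * b 0) * c (suc n) + ((λ i → a 0 * b (suc i) + (tail a ⊙ b) i) ⊙ c) n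
    ≈⟨ +-cong refl (⊙-linearˡ (a 0) (tail b) (tail a ⊙ b) c n) ⟩
      (a 0 * b 0) * c (suc n) + (a 0 * (tail b ⊙ c) n + ((tail a ⊙ b) ⊙ c) n)
    ≈⟨ +-cong refl (+-cong refl (⊙-assoc (tail a) b c n)) ⟩
      (a 0 * b 0) * c (suc n) + (a 0 * (tail b ⊙ c) n + (tail a ⊙ (b ⊙ c)) n)
    ≈⟨ regroup _ _ _ _ _ ⟩
      a 0 * (b 0 * c (suc n) + (tail b ⊙ c) n) + (tail a ⊙ (b ⊙ c)) n
    ≈⟨ +-cong (*-cong refl (coeff-suc b c n)) refl ⟨
      a 0 * (b ⊙ c) (suc n) + (tail a ⊙ (b ⊙ c)) n
    ≈⟨ coeff-suc a (b ⊙ c) n ⟨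
      (a ⊙ (b ⊙ c)) (suc n)
    ∎
    where
    regroup : ∀ x y s t u → (x * y) * s + (x * t + u) ≈ x * (y * s + t) + u
    regroup x y s t u = trans (sym (+-assoc _ _ _))
      (+-cong (trans (+-cong (*-assoc x y s) refl) (sym (distribˡ x _ _))) refl)

  shift-step : ∀ k f b m → (shiftS K (suc k) f ⊙ b) (suc m) ≈ (shiftS K k f ⊙ b) m
  shift-step k f b m =
    trans (coeff-suc (shiftS K (suc k) f) b m) (trans (+-cong (zeroˡ _) refl) (+-identityˡ _))

  coeff-solve : ∀ a b v → a 0 * v ≈ 1# → ∀ n →
    b (suc n) ≈ v * ((a ⊙ b) (suc n) - (a 1 * b n + Σ< n (λ t → a (suc (suc t)) * b (n ∸ suc t))))
  coeff-solve a b v a₀v≈1 n = sym (begin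
      v * ((a ⊙ b) (suc n) - Y)
    ≈⟨ *-cong refl (+-cong (coeff-suc₂ a b n) refl) ⟩
      v * ((a 0 * b (suc n) + Y) - Y)
    ≈⟨ *-cong refl (trans (+-assoc _ _ _) (trans (+-cong refl (-‿inverseʳ Y)) (+-identityʳ _))) ⟩
      v * (a 0 * b (suc n))
    ≈⟨ trans (sym (*-assoc v (a 0) _)) (*-cong (*-comm v (a 0)) refl) ⟩
      (a 0 * v) * b (suc n)
    ≈⟨ *-cong a₀v≈1 refl ⟩
      1# * b (suc n)
    ≈⟨ *-identityˡ _ ⟩
      b (suc n)
    ∎)
    where
    Y : Carrier
    Y = a 1 * b n + Σ< n (λ t → a (suc (suc t)) * b (n ∸ suc t))

  module InverseSeries (g : Series K) (g₀≉0 : ¬ (g 0 ≈ 0#)) where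

    v : Carrier
    v = inv K (g 0) g₀≉0

    g₀v≈1 : g 0 * v ≈ 1#
    g₀v≈1 = proj₂ (inverse (g 0) g₀≉0)

    h : Series K
    h = invS K g g₀≉0

    nextEntry : ℕ → Carrier
    nextEntry N = - (v * Σ< (suc N) (λ i → g (suc i) * invTab K g v N (N ∸ i)))

    invTab-keep : ∀ N m → m ≤ N → invTab K g v (suc N) m P.≡ invTab K g v N m
    invTab-keep N m m≤N with m ≤ᵇ N | ℕ.≤⇒≤ᵇ {m} {N} m≤N
    ... | true | _ = P.refl

    invTab-new : ∀ N m → ¬ (m ≤ N) → invTab K g v (suc N) m P.≡ nextEntry N
    invTab-new N m m≰N with m ≤ᵇ N | ℕ.≤ᵇ⇒≤ m N
    ... | true  | m≤N = ⊥-elim (m≰N (m≤N tt))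
    ... | false | _   = P.refl

    invTab-stable : ∀ N m → m ≤ N → invTab K g v N m P.≡ h m
    invTab-stable zero    zero z≤n = P.refl
    invTab-stable (suc N) m m≤N+1 with ℕ.m≤n⇒m<n∨m≡n m≤N+1
    ... | inj₂ P.refl = P.refl
    ... | inj₁ m<N+1  = P.trans (invTab-keep N m (ℕ.≤-pred m<N+1))
                                (invTab-stable N m (ℕ.≤-pred m<N+1))

    h-suc : ∀ n → h (suc n) ≈ - (v * (tail g ⊙ h) n)
    h-suc n = trans (≡⇒≈ (invTab-new n (suc n) (ℕ.<⇒≱ (ℕ.n<1+n n))))
      (-‿cong (*-cong refl (sum-cong (suc n) λ i →
        *-cong refl (≡⇒≈ (invTab-stable n (n ∸ i) (ℕ.m∸n≤m n i))))))

    g⊙h≋1 : (g ⊙ h) ≋ oneS K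
    g⊙h≋1 zero    = trans (coeff-zero g h) g₀v≈1
    g⊙h≋1 (suc n) = begin
        (g ⊙ h) (suc n)
      ≈⟨ coeff-suc g h n ⟩
        g 0 * h (suc n) + S
      ≈⟨ +-cong (*-cong refl (h-suc n)) refl ⟩
        g 0 * - (v * S) + S
      ≈⟨ +-cong (trans (sym (-‿distribʳ-* (g 0) (v * S))) (-‿cong (sym (*-assoc (g 0) v S)))) refl ⟩
        - ((g 0 * v) * S) + S
      ≈⟨ +-cong (-‿cong (trans (*-cong g₀v≈1 refl) (*-identityˡ S))) refl ⟩
        - S + S
      ≈⟨ -‿inverseˡ S ⟩
        0#
      ∎
      where
      S : Carrier
      S = (tail g ⊙ h) n

  -- For row m + 1 and column j it says
  --   d(m+1, j) = v (source − g₁ d(m, j) − Σ_{t<m} g(t+2) d(m-1-t, j)),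
  -- where the source is f(m+1) in column 0 and d(m, j-1) in column j > 0
  -- (coming from the term x p_m).

  source : Matrix K → Series K → ℕ → ℕ → Carrier
  source d f m zero    = f (suc m)
  source d f m (suc j) = d m j

  lowerSum : Matrix K → Series K → ℕ → ℕ → Carrier
  lowerSum d g m j = Σ< m (λ t → g (suc (suc t)) * d (m ∸ suc t) j)

  distribute-step : ∀ v g₁ c x r → v * (r - (g₁ * c + x)) ≈ (- (v * g₁) * c + v * r) - v * x
  distribute-step v g₁ c x r = begin
      v * (r - (g₁ * c + x))
    ≈⟨ distribˡ v r _ ⟩
      v * r + v * - (g₁ * c + x)
    ≈⟨ +-cong refl (-‿distribʳ-* v _) ⟨
      v * r + - (v * (g₁ * c + x))
    ≈⟨ +-cong refl (-‿cong (distribˡ v _ _)) ⟩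
      v * r + - (v * (g₁ * c) + v * x)
    ≈⟨ regroup _ _ _ ⟩
      (- (v * (g₁ * c)) + v * r) - v * x
    ≈⟨ +-cong (+-cong (-‿cong (*-assoc v g₁ c)) refl) refl ⟨
      (- ((v * g₁) * c) + v * r) - v * x
    ≈⟨ +-cong (+-cong (-‿distribˡ-* (v * g₁) c) refl) refl ⟩
      (- (v * g₁) * c + v * r) - v * x
    ∎
    where
    regroup : ∀ a b e → a + - (b + e) ≈ (- b + a) - e
    regroup = solve 3 (λ a b e → (a ⊕ ⊝ (b ⊕ e)) ⊜ ((⊝ b ⊕ a) ⊕ ⊝ e)) refl

  recRHS-suc : ∀ d f g v m j → recRHS K d f g v (suc m) j
    ≈ v * (source d f m j - (g 1 * d m j + lowerSum d g m j))
  recRHS-suc d f g v m j = sym (trans (distribute-step v (g 1) (d m j) (lowerSum d g m j) _)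
                                      (coefficientwise j))
    where
    q : Series K
    q = _·S_ K v (_-S_ K (xS K) (constS K (g 1)))

    q₀ : q 0 ≈ - (v * g 1)
    q₀ = trans (*-cong refl (+-identityˡ _)) (sym (-‿distribʳ-* v (g 1)))

    q₁ : q 1 ≈ v
    q₁ = trans (*-cong refl (trans (+-cong refl -0#≈0#) (+-identityʳ 1#))) (*-identityʳ v)

    q-linear : tail (tail q) ≋ zeroS K
    q-linear _ = trans (*-cong refl (-‿inverseʳ 0#)) (zeroʳ v)

    p : Series K
    p = polys K d m

    scaledSum : ∀ j → Σ< m (λ t → (g (suc (suc t)) * v) * d (m ∸ suc t) j) ≈ v * lowerSum d g m j
    scaledSum j = trans (sum-cong m λ t →
        trans (*-cong (*-comm (g (suc (suc t))) v) refl) (*-assoc v (g (suc (suc t))) _))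
      (sum-scale m v _)

    coefficientwise : ∀ j → (- (v * g 1) * d m j + v * source d f m j) - v * lowerSum d g m j
                            ≈ recRHS K d f g v (suc m) j
    coefficientwise zero = begin
        (- (v * g 1) * d m 0 + v * f (suc m)) - v * lowerSum d g m 0
      ≈⟨ swap-last _ _ _ ⟨
        (- (v * g 1) * d m 0 - v * lowerSum d g m 0) + v * f (suc m)
      ≈⟨ +-cong (+-cong (trans (*-cong (sym q₀) refl) (sym (coeff-zero q p)))
                        (-‿cong (sym (scaledSum 0))))
                (*-comm v (f (suc m))) ⟩
        recRHS K d f g v (suc m) 0
      ∎
      where
      swap-last : ∀ a b e → (a - e) + b ≈ (a + b) - e
      swap-last = solve 3 (λ a b e → ((a ⊕ ⊝ e) ⊕ b) ⊜ ((a ⊕ b) ⊕ ⊝ e)) refl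
    coefficientwise (suc j) = begin
        (- (v * g 1) * d m (suc j) + v * d m j) - v * lowerSum d g m (suc j)
      ≈⟨ +-cong (+-cong (*-cong (sym q₀) refl) (*-cong (sym q₁) refl)) (-‿cong (sym (scaledSum (suc j)))) ⟩
        (q 0 * p (suc j) + q 1 * p j) - Σ< m (λ t → (g (suc (suc t)) * v) * d (m ∸ suc t) (suc j))
      ≈⟨ +-cong (+-cong refl (⊙-constant (tail q) p q-linear j)) refl ⟨
        (q 0 * p (suc j) + (tail q ⊙ p) j) - Σ< m (λ t → (g (suc (suc t)) * v) * d (m ∸ suc t) (suc j))
      ≈⟨ +-cong (coeff-suc q p j) refl ⟨
        (q ⊙ p) (suc j) - Σ< m (λ t → (g (suc (suc t)) * v) * d (m ∸ suc t) (suc j))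
      ≈⟨ +-identityʳ _ ⟨
        recRHS K d f g v (suc m) (suc j)
      ∎

  module Columns (f g : Series K) (g₀≉0 : ¬ (g 0 ≈ 0#)) where
    open InverseSeries g g₀≉0

    Tfg : Matrix K
    Tfg = T K f g g₀≉0

    column : ℕ → Series K
    column k = shiftS K k f ⊙ (h ⊙ powS K h k)

    -- g C_k = x^k f h^k, because g h = 1.
    g-column : ∀ k → (g ⊙ column k) ≋ (shiftS K k f ⊙ powS K h k)
    g-column k n = begin
        (g ⊙ (xᵏf ⊙ (h ⊙ hᵏ))) n   ≈⟨ ⊙-assoc g xᵏf (h ⊙ hᵏ) n ⟨
        ((g ⊙ xᵏf) ⊙ (h ⊙ hᵏ)) n   ≈⟨ ⊙-cong {b = h ⊙ hᵏ} (⊙-comm g xᵏf) (λ _ → refl) n ⟩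
        ((xᵏf ⊙ g) ⊙ (h ⊙ hᵏ)) n   ≈⟨ ⊙-assoc xᵏf g (h ⊙ hᵏ) n ⟩
        (xᵏf ⊙ (g ⊙ (h ⊙ hᵏ))) n   ≈⟨ ⊙-cong {a = xᵏf} (λ _ → refl) g⊙h⊙hᵏ≋hᵏ n ⟩
        (xᵏf ⊙ hᵏ) n               ∎
      where
      xᵏf hᵏ : Series K
      xᵏf = shiftS K k f
      hᵏ  = powS K h k

      g⊙h⊙hᵏ≋hᵏ : (g ⊙ (h ⊙ hᵏ)) ≋ hᵏ
      g⊙h⊙hᵏ≋hᵏ i = trans (sym (⊙-assoc g h hᵏ i))
        (trans (⊙-cong {b = hᵏ} g⊙h≋1 (λ _ → refl) i) (⊙-identityˡ hᵏ i))

    -- Hence g C_0 = f and g C_(k+1) = x C_k, i.e. the coefficient of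
    -- x^(m+1) in g C_k is the source term of the recurrence.
    g-column-source : ∀ k m → (g ⊙ column k) (suc m) ≈ source Tfg f m k
    g-column-source zero    m = trans (g-column zero (suc m)) (⊙-identityʳ f (suc m))
    g-column-source (suc k) m = trans (g-column (suc k) (suc m)) (shift-step k f (powS K h (suc k)) m)

    T-recurrence : Recurrence K Tfg f g g₀≉0
    T-recurrence zero zero =
      trans (coeff-zero f (h ⊙ oneS K)) (*-cong refl (⊙-identityʳ h 0))
    T-recurrence zero (suc j) = trans (coeff-zero (shiftS K (suc j) f) (powS K h (suc (suc j)))) (zeroˡ _)
    T-recurrence (suc m) k = trans
      (coeff-solve g (column k) v g₀v≈1 m)
      (trans (*-cong refl (+-cong (g-column-source k m) refl)) (sym (recRHS-suc Tfg f g v m k)))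

  recRHS-cong : ∀ (d e : Matrix K) f g v n → (∀ k → k < n → ∀ j → d k j ≈ e k j) →
                recRHS K d f g v n ≋ recRHS K e f g v n
  recRHS-cong d e f g v zero    d≈e j = refl
  recRHS-cong d e f g v (suc m) d≈e j = +-cong
    (+-cong (⊙-cong (λ _ → refl) (d≈e m (ℕ.n<1+n m)) j)
            (-‿cong (sum-cong m λ t → *-cong refl (d≈e (m ∸ suc t) (s≤s (ℕ.m∸n≤m m (suc t))) j))))
    refl

  recurrence-unique : ∀ (d e : Matrix K) f g g₀≉0 →
    Recurrence K d f g g₀≉0 → Recurrence K e f g g₀≉0 → _≈M_ K d e
  recurrence-unique d e f g g₀≉0 rec-d rec-e n = agreeBelow (suc n) n (ℕ.n<1+n n)
    where
    agreeBelow : ∀ n k → k < n → ∀ j → d k j ≈ e k j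
    agreeBelow (suc n) k k<n+1 j with ℕ.m<1+n⇒m<n∨m≡n k<n+1
    ... | inj₁ k<n    = agreeBelow n k k<n j
    ... | inj₂ P.refl = trans (rec-d k j)
      (trans (recRHS-cong d e f g (inv K (g 0) g₀≉0) k (agreeBelow k) j) (sym (rec-e k j)))

  riordan⇒recurrence : ∀ (d : Matrix K) f g g₀≉0 →
    _≈M_ K d (T K f g g₀≉0) → Recurrence K d f g g₀≉0
  riordan⇒recurrence d f g g₀≉0 d≈T n j =
    trans (d≈T n j) (trans (T-recurrence n j)
      (recRHS-cong (T K f g g₀≉0) d f g (inv K (g 0) g₀≉0) n (λ k _ i → sym (d≈T k i)) j))
    where open Columns f g g₀≉0 using (T-recurrence)

  recurrence⇒riordan : ∀ (d : Matrix K) f g g₀≉0 →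
    Recurrence K d f g g₀≉0 → _≈M_ K d (T K f g g₀≉0)
  recurrence⇒riordan d f g g₀≉0 rec =
    recurrence-unique d (T K f g g₀≉0) f g g₀≉0 rec (Columns.T-recurrence f g g₀≉0)

open Development

mainTheorem1 : ∀ {c ℓ : Level} (K : Field c ℓ) → CharZero K →
    (d : Matrix K) → LowerTriangular K d →
    ((Σ (Series K) λ f → Σ (Series K) λ g → Σ (¬ Field._≈_ K (g 0) (Field.0# K)) λ g0≉0 →
    _≈M_ K d (T K f g g0≉0))
    ⇔
    (Σ (Series K) λ f → Σ (Series K) λ g → Σ (¬ Field._≈_ K (g 0) (Field.0# K)) λ g0≉0 →
    Recurrence K d f g g0≉0))
    ×
    (∀ (f g : Series K) (g0≉0 : ¬ Field._≈_ K (g 0) (Field.0# K)) →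
    Recurrence K d f g g0≉0 → _≈M_ K d (T K f g g0≉0))
mainTheorem1 K _ d _ =
  mk⇔ (λ (f , g , g₀≉0 , d≈T) → f , g , g₀≉0 , riordan⇒recurrence K d f g g₀≉0 d≈T)
      (λ (f , g , g₀≉0 , rec) → f , g , g₀≉0 , recurrence⇒riordan K d f g g₀≉0 rec)
  , recurrence⇒riordan K d
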